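{- Let $n\ge3$. There is no weight-preserving bijection $\varphi$ from the set of arrowed monotone triangles with bottom row $(1,\ldots,n)$ to the set of SBCSPPs of order $n$ such that the map sending each DPP-SBCSPP $D$ to the underlying monotone triangle of $\varphi^{ -1}(D)$ (obtained by ignoring the decorations) is a bijection from the set of DPP-SBCSPPs of order $n$ onto the set of monotone triangles with bottom row $(1,\ldots,n)$.
   Context: Monotone triangle with $n$ rows: $(m_{i,j})_{1\le j\le i\le n}$ integers with $m_{i+1,j}\le m_{i,j}\le m_{i+1,j+1}$, $m_{i,j}<m_{i,j+1}$, row $n$ the bottom row. Arrowed monotone triangle: each entry decorated by one of $\nearrow,\nwarrow,\nwarrow\!\nearrow$, where an entry equal to its northwest-neighbour $m_{i-1,j-1}$ must carry $\nearrow$ and an entry equal to its northeast-neighbour $m_{i-1,j}$ must carry $\nwarrow$; weight $u^{\#\nearrow} v^{\#\nwarrow} w^{\#\nwarrow\nearrow}\prod_{i=1}^n X_i^{(\text{sum of row } i)-(\text{sum of row } i-1)+(\#\nearrow\text{ in row } i)-(\#\nwarrow\text{ in row } i)}$ (row $0$ sum is $0$). Near-balanced partition $(a_1,\ldots,a_l\mid b_1,\ldots,b_l)$ (Frobenius notation): $a_i\in\{b_i,b_i+1\}$ for all $i$, with weight $w^{l+\sum(b_i-a_i)}$. SBCSPP of order $n$: filling of a near-balanced Young diagram with nonempty subsets of $\{1,\ldots,n\}$, singletons strictly above the main diagonal, maxima weakly decreasing along rows, all elements of a cell strictly greater than all elements of the cell below; weight $w^{l+\sum(b_i-a_i)}u^{\#\text{cells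 strictly above diagonal}}v^{\binom{n+1}2-\#\text{entries on/below diagonal}}w^{\#\text{entries}-\#\text{cells}}\prod_i X_i^{\#i\text{'s}}$ (entries = set elements over all cells). A DPP-SBCSPP is an SBCSPP in which (1) every cell contains a single element, (2) the shape satisfies $a_i=b_i+1$ for all $i$, (3) for each diagonal cell with entry $d$, the entries below it in its column are $d-1,d-2,\ldots,1$, and (4) no $1$ appears strictly above the diagonal. Weight-preserving means $\mathrm{W}(\varphi(A))=\mathrm{W}(A)$ as monomials in $u,v,w,X_1,\ldots,X_n$. -}

module Defs where

open import Data.Nat using (ℕ; zero; suc; _+_; _*_; _∸_; _≤_; _<_; _≡ᵇ_; _≤ᵇ_; _⊔_)
open import Data.Nat.Combinatorics using (_C_)
open import Data.Integer as ℤ using (ℤ; +_; 0ℤ)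
open import Data.Bool using (Bool; true; false)
open import Data.List using (List; []; _∷_; [_]; length; map; upTo; concat; concatMap; foldr)
open import Data.List.Membership.Propositional using (_∈_)
open import Data.List.Relation.Unary.All using (All)
open import Data.List.Relation.Unary.AllPairs using (AllPairs)
open import Data.Product using (Σ; _×_; _,_; proj₁; proj₂)
open import Data.Sum using (_⊎_)
open import Relation.Binary.PropositionalEquality using (_≡_; _≢_)
open import Relation.Nullary using (¬_)

nth : {A : Set} → A → List A → ℕ → A
nth d []       _       = d
nth d (x ∷ xs) zero    = x
nth d (x ∷ xs) (suc k) = nth d xs k

countB : {A : Set} → (A → Bool) → List A → ℕ
countB p []       = 0
countB p (x ∷ xs) with p x
... | true  = suc (countB p xs)
... | false = countB p xs

sumℤ : List ℤ → ℤ
sumℤ = foldr ℤ._+_ 0ℤ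

rowAt : {A : Set} → List (List A) → ℕ → List A
rowAt t i = nth [] t (i ∸ 1)

at : {A : Set} → A → List (List A) → ℕ → ℕ → A
at d t i j = nth d (rowAt t i) (j ∸ 1)

oneToN : ℕ → List ℤ
oneToN n = map (λ k → + suc k) (upTo n)

-- Monomials in u, v, w, X₁ … Xₙ, represented by exponent vectors

record Monomial : Set where
  constructor mono
  field
    eu : ℤ
    ev : ℤ
    ew : ℤ
    eX : List ℤ

-- Monotone triangles: row i (1-based) is the i-th list; row n is the bottom

Triangle : Set
Triangle = List (List ℤ)

ent : Triangle → ℕ → ℕ → ℤ
ent = at 0ℤ

IsMonotoneTriangle : ℕ → Triangle → Set
IsMonotoneTriangle n t =
    length t ≡ n
  × (∀ i → 1 ≤ i → i ≤ n → length (rowAt t i) ≡ i)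
  × (∀ i j → 1 ≤ j → j ≤ i → i < n →
       (ent t (suc i) j ℤ.≤ ent t i j) × (ent t i j ℤ.≤ ent t (suc i) (suc j)))
  × (∀ i j → 1 ≤ j → j < i → i ≤ n → ent t i j ℤ.< ent t i (suc j))

IsMTBottom : ℕ → Triangle → Set
IsMTBottom n t = IsMonotoneTriangle n t × rowAt t n ≡ oneToN n

data Arrow : Set where
  ↗ ↖ ↖↗ : Arrow

isNE isNW isNWNE : Arrow → Bool
isNE ↗ = true
isNE _ = false
isNW ↖ = true
isNW _ = false
isNWNE ↖↗ = true
isNWNE _ = false

ATriangle : Set
ATriangle = List (List (ℤ × Arrow))

underlying : ATriangle → Triangle
underlying = map (map proj₁)

arr : ATriangle → ℕ → ℕ → Arrow
arr t i j = proj₂ (at (0ℤ , ↗) t i j)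

IsArrowedMTBottom : ℕ → ATriangle → Set
IsArrowedMTBottom n t =
    IsMTBottom n (underlying t)
  × (∀ i j → 2 ≤ i → i ≤ n → 1 ≤ j → j ≤ i →
       (2 ≤ j → ent (underlying t) i j ≡ ent (underlying t) (i ∸ 1) (j ∸ 1) → arr t i j ≡ ↗)
     × (j < i → ent (underlying t) i j ≡ ent (underlying t) (i ∸ 1) j → arr t i j ≡ ↖))

xExpsA : ℤ → ATriangle → List ℤ
xExpsA prev [] = []
xExpsA prev (r ∷ rs) =
  (s ℤ.- prev ℤ.+ + countB (λ e → isNE (proj₂ e)) r ℤ.- + countB (λ e → isNW (proj₂ e)) r)
    ∷ xExpsA s rs
  where s = sumℤ (map proj₁ r)

weightA : ATriangle → Monomial
weightA t = mono (+ countB (λ e → isNE (proj₂ e)) (concat t))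
                 (+ countB (λ e → isNW (proj₂ e)) (concat t))
                 (+ countB (λ e → isNWNE (proj₂ e)) (concat t))
                 (xExpsA 0ℤ t)

-- Fillings of Young diagrams by subsets (SBCSPP candidates).
-- Row i (1-based) is the i-th list; each cell is a set, represented
-- canonically as a strictly increasing list of natural numbers.

Filling : Set
Filling = List (List (List ℕ))

cell : Filling → ℕ → ℕ → List ℕ
cell = at []

rowLen : Filling → ℕ → ℕ
rowLen t i = length (rowAt t i)

colLen : Filling → ℕ → ℕ
colLen t j = countB (λ r → j ≤ᵇ length r) t

InShape : Filling → ℕ → ℕ → Set
InShape t i j = 1 ≤ i × i ≤ length t × 1 ≤ j × j ≤ rowLen t i

IsPartitionShape : Filling → Set
IsPartitionShape t =
    (∀ i → 1 ≤ i → i ≤ length t → 1 ≤ rowLen t i)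
  × (∀ i → 1 ≤ i → i < length t → rowLen t (suc i) ≤ rowLen t i)

indexed : {A : Set} → ℕ → List A → List (ℕ × A)
indexed k []       = []
indexed k (x ∷ xs) = (k , x) ∷ indexed (suc k) xs

-- Frobenius coordinates: l = Durfee size, a_i = λ_i - i, b_i = λ'_i - i
frobL : Filling → ℕ
frobL t = countB (λ p → proj₁ p ≤ᵇ length (proj₂ p)) (indexed 1 t)

frobA : Filling → ℕ → ℕ
frobA t i = rowLen t i ∸ i

frobB : Filling → ℕ → ℕ
frobB t i = colLen t i ∸ i

IsNearBalanced : Filling → Set
IsNearBalanced t =
  ∀ i → 1 ≤ i → i ≤ frobL t → (frobA t i ≡ frobB t i) ⊎ (frobA t i ≡ suc (frobB t i))

maxL : List ℕ → ℕ
maxL = foldr _⊔_ 0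

IsSBCSPP : ℕ → Filling → Set
IsSBCSPP n t =
    IsPartitionShape t
  × IsNearBalanced t
  × (∀ i j → InShape t i j →
       (cell t i j ≢ []) × AllPairs _<_ (cell t i j) × All (λ x → 1 ≤ x × x ≤ n) (cell t i j))
  × (∀ i j → InShape t i j → i < j → length (cell t i j) ≡ 1)
  × (∀ i j → 1 ≤ j → InShape t i (suc j) → maxL (cell t i (suc j)) ≤ maxL (cell t i j))
  × (∀ i j → 1 ≤ i → InShape t (suc i) j →
       ∀ x → x ∈ cell t i j → ∀ y → y ∈ cell t (suc i) j → y < x)

cellsIx : Filling → List (ℕ × ℕ × List ℕ)
cellsIx t = concatMap (λ p → map (λ q → (proj₁ p , proj₁ q , proj₂ q)) (indexed 1 (proj₂ p)))
                      (indexed 1 t)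

entriesOnOrBelowDiag : Filling → ℕ
entriesOnOrBelowDiag t =
  foldr _+_ 0 (map (λ c → if′ (proj₁ (proj₂ c) ≤ᵇ proj₁ c) (length (proj₂ (proj₂ c)))) (cellsIx t))
  where
    if′ : Bool → ℕ → ℕ
    if′ true  k = k
    if′ false k = 0

cellsAboveDiag : Filling → ℕ
cellsAboveDiag t = countB (λ c → suc (proj₁ c) ≤ᵇ proj₁ (proj₂ c)) (cellsIx t)

numCells : Filling → ℕ
numCells t = length (cellsIx t)

allEntries : Filling → List ℕ
allEntries t = concat (concat t)

frobDefect : Filling → ℤ
frobDefect t = sumℤ (map (λ k → + frobB t (suc k) ℤ.- + frobA t (suc k)) (upTo (frobL t)))

weightS : ℕ → Filling → Monomial
weightS n t =
  mono (+ cellsAboveDiag t)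
       (+ (suc n C 2) ℤ.- + entriesOnOrBelowDiag t)
       ((+ frobL t ℤ.+ frobDefect t) ℤ.+ (+ length (allEntries t) ℤ.- + numCells t))
       (map (λ k → + countB (λ x → x ≡ᵇ suc k) (allEntries t)) (upTo n))

IsDPPSBCSPP : ℕ → Filling → Set
IsDPPSBCSPP n t =
    IsSBCSPP n t
  × (∀ i j → InShape t i j → length (cell t i j) ≡ 1)
  × (∀ i → 1 ≤ i → i ≤ frobL t → frobA t i ≡ suc (frobB t i))
  × (∀ i d → InShape t i i → cell t i i ≡ [ d ] →
       (colLen t i ≡ i + d ∸ 1) × (∀ k → i < k → k ≤ colLen t i → cell t k i ≡ [ d ∸ (k ∸ i) ]))
  × (∀ i j → InShape t i j → i < j → ¬ (1 ∈ cell t i j))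

IsBijectionBetween : {A B : Set} → (A → Set) → (B → Set) → (A → B) → (B → A) → Set
IsBijectionBetween {A} {B} P Q f g =
    (∀ a → P a → Q (f a))
  × (∀ b → Q b → P (g b))
  × (∀ a → P a → g (f a) ≡ a)
  × (∀ b → Q b → f (g b) ≡ b)

IsBijectiveOnto : {A B : Set} → (A → Set) → (B → Set) → (A → B) → Set
IsBijectiveOnto {A} {B} P Q f =
    (∀ a → P a → Q (f a))
  × (∀ a a′ → P a → P a′ → f a ≡ f a′ → a ≡ a′)
  × (∀ b → Q b → Σ A (λ a → P a × f a ≡ b))

-- The hooks with first row 3 x x 2 and first column 3 2 1 (x = 2, 3) are distinct DPP-SBCSPPs whose
-- weights have w-exponent 0, X₁-exponent 1, X₂-exponent 4 resp. 2 and no Xⱼ with j ≥ 4, so φ⁻¹ sends both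
-- to arrowed monotone triangles with these exponents; such a triangle is unique. Going up from the bottom
-- row (1,…,n): the Xᵢ-exponent of row i is its first entry plus the first arrow's contribution plus, for
-- every other entry x with northwest neighbour u, the quantity x − u + (1, −1, 0 for ↗, ↖, ↖↗), which is
-- nonnegative and vanishes only if x = u + 1. So if row i starts with 1 and its exponent vanishes, row i − 1
-- is (1,…,i−1); this fixes rows 3,…,n. Without ↖↗ arrows, X₁ = 1 then forces the apex 2, and X₂ ∉ {1,3}
-- forces the second row (1,3). Both hooks thus have the same underlying monotone triangle.

module Submission where

open import Defs
open import Data.Nat using (ℕ; _≤_)
open import Data.Product using (Σ; _×_)
open import Relation.Binary.PropositionalEquality using (_≡_)
open import Relation.Nullary using (¬_)

open import Data.Bool using (Bool; false)
open import Data.Integer as ℤ using (ℤ; +_; 0ℤ; -1ℤ; +≤+; +<+; _+_; _-_)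
import Data.Integer.Properties as ℤP
open import Data.Integer.Tactic.RingSolver using (solve-∀)
open import Data.List using (List; []; _∷_; [_]; map; length; concat; drop; applyUpTo)
open import Data.List.Properties using (map-injective; ∷-injective; map-applyUpTo; length-map; length-drop; length-applyUpTo)
open import Data.List.Membership.Propositional using (_∈_)
open import Data.List.Relation.Unary.All using (All; []; _∷_)
open import Data.List.Relation.Unary.AllPairs using (AllPairs; []; _∷_)
open import Data.List.Relation.Unary.Any using (here)
import Data.List.Relation.Unary.All.Properties as All
open import Data.List.Relation.Binary.Pointwise using (Pointwise; []; _∷_; Pointwise-≡⇒≡)
open import Data.Nat as ℕ using (zero; suc; _<_; z≤n; s≤s)
import Data.Nat.Properties as ℕP
open import Data.Product using (_,_; proj₁; proj₂)
open import Data.Sum using (inj₂)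
open import Function using (_∘_)
open import Relation.Nullary using (contradiction)
open import Relation.Binary.PropositionalEquality using (refl; sym; trans; cong; cong₂; subst; subst₂; _≢_; module ≡-Reasoning)

nth-map : {A B : Set} (f : A → B) (d : A) (xs : List A) (i : ℕ) →
  nth (f d) (map f xs) i ≡ f (nth d xs i)
nth-map f d []       i       = refl
nth-map f d (x ∷ xs) zero    = refl
nth-map f d (x ∷ xs) (suc i) = nth-map f d xs i

nth-drop1 : {A : Set} (d : A) (xs : List A) (i : ℕ) → nth d (drop 1 xs) i ≡ nth d xs (suc i)
nth-drop1 d []       i = refl
nth-drop1 d (x ∷ xs) i = refl

nth-applyUpTo : {A : Set} (d : A) (f : ℕ → A) {n i : ℕ} → i < n → nth d (applyUpTo f n) i ≡ f i
nth-applyUpTo d f {suc n} {zero}  _         = refl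
nth-applyUpTo d f {suc n} {suc i} (s≤s i<n) = nth-applyUpTo d (f ∘ suc) i<n

applyUpTo-nth : {A : Set} (d : A) (xs : List A) → xs ≡ applyUpTo (nth d xs) (length xs)
applyUpTo-nth d []       = refl
applyUpTo-nth d (x ∷ xs) = cong (x ∷_) (applyUpTo-nth d xs)

pointwise-nth : {A B : Set} {R : A → B → Set} (a : A) (b : B) {xs : List A} {ys : List B} →
  length xs ≡ length ys → (∀ i → i < length xs → R (nth a xs i) (nth b ys i)) → Pointwise R xs ys
pointwise-nth a b {[]}     {[]}     _   _ = []
pointwise-nth a b {x ∷ xs} {y ∷ ys} len R =
  R 0 (s≤s z≤n) ∷ pointwise-nth a b (ℕP.suc-injective len) (λ i i< → R (suc i) (s≤s i<))

All-nth : {A : Set} {P : A → Set} (d : A) {xs : List A} → All P xs → ∀ {i} → i < length xs → P (nth d xs i)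
All-nth d (px ∷ _)   {zero}  _         = px
All-nth d (_ ∷ pxs) {suc i} (s≤s i<n) = All-nth d pxs i<n

countB≡0⇒All : {A : Set} (p : A → Bool) (xs : List A) → countB p xs ≡ 0 → All (λ x → p x ≡ false) xs
countB≡0⇒All p []       _ = []
countB≡0⇒All p (x ∷ xs) h with p x in px
... | false = px ∷ countB≡0⇒All p xs h

ℤsuc-injective : {i j : ℤ} → ℤ.suc i ≡ ℤ.suc j → i ≡ j
ℤsuc-injective {i} {j} e = trans (sym (ℤP.pred-suc i)) (trans (cong ℤ.pred e) (ℤP.pred-suc j))

oneToN-suc : ∀ k → oneToN (suc k) ≡ + 1 ∷ map ℤ.suc (oneToN k)
oneToN-suc k = cong (+ 1 ∷_) (trans (map-applyUpTo suc _ k)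
  (sym (trans (cong (map ℤ.suc) (map-applyUpTo (λ j → j) _ k)) (map-applyUpTo _ ℤ.suc k))))

arrowExp : Arrow → ℤ
arrowExp ↗  = + 1
arrowExp ↖  = -1ℤ
arrowExp ↖↗ = 0ℤ

arrowBalance : List (ℤ × Arrow) → ℤ
arrowBalance r = sumℤ (map (arrowExp ∘ proj₂) r)

rowSum : List (ℤ × Arrow) → ℤ
rowSum r = sumℤ (map proj₁ r)

rowExp : ℤ → List (ℤ × Arrow) → ℤ
rowExp s r = rowSum r - s + + countB (isNE ∘ proj₂) r - + countB (isNW ∘ proj₂) r

counts≡arrowBalance : ∀ r → + countB (isNE ∘ proj₂) r - + countB (isNW ∘ proj₂) r ≡ arrowBalance r
counts≡arrowBalance []             = refl
counts≡arrowBalance ((_ , ↗) ∷ r)  =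
  trans (shift (+ countB (isNE ∘ proj₂) r) (+ countB (isNW ∘ proj₂) r)) (cong ℤ.suc (counts≡arrowBalance r))
  where
  shift : ∀ (p q : ℤ) → (+ 1 + p) - q ≡ + 1 + (p - q)
  shift = solve-∀
counts≡arrowBalance ((_ , ↖) ∷ r)  =
  trans (shift (+ countB (isNE ∘ proj₂) r) (+ countB (isNW ∘ proj₂) r)) (cong ℤ.pred (counts≡arrowBalance r))
  where
  shift : ∀ (p q : ℤ) → p - (+ 1 + q) ≡ -1ℤ + (p - q)
  shift = solve-∀
counts≡arrowBalance ((_ , ↖↗) ∷ r) = trans (counts≡arrowBalance r) (sym (ℤP.+-identityˡ _))

rowExp≡ : ∀ s r → rowExp s r ≡ rowSum r - s + arrowBalance r
rowExp≡ s r = trans (regroup (rowSum r) s (+ countB (isNE ∘ proj₂) r) (+ countB (isNW ∘ proj₂) r))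
                    (cong (λ b → rowSum r - s + b) (counts≡arrowBalance r))
  where
  regroup : ∀ (x s p q : ℤ) → x - s + p - q ≡ x - s + (p - q)
  regroup = solve-∀

rowExp-∷ : ∀ s e r → rowExp s (e ∷ r) ≡ (proj₁ e + arrowExp (proj₂ e)) + rowExp s r
rowExp-∷ s e r = begin
  rowExp s (e ∷ r)                                             ≡⟨ rowExp≡ s (e ∷ r) ⟩
  (proj₁ e + rowSum r) - s + (arrowExp (proj₂ e) + arrowBalance r)
    ≡⟨ regroup (proj₁ e) (rowSum r) s (arrowExp (proj₂ e)) (arrowBalance r) ⟩
  (proj₁ e + arrowExp (proj₂ e)) + (rowSum r - s + arrowBalance r)
    ≡⟨ cong (λ q → proj₁ e + arrowExp (proj₂ e) + q) (sym (rowExp≡ s r)) ⟩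
  (proj₁ e + arrowExp (proj₂ e)) + rowExp s r              ∎
  where
  open ≡-Reasoning
  regroup : ∀ (x S s a B : ℤ) → (x + S) - s + (a + B) ≡ (x + a) + (S - s + B)
  regroup = solve-∀

gap : ℤ × Arrow → ℤ → ℤ
gap (x , a) u = x - u + arrowExp a

rowExp-∷-∷ : ∀ e r u us → rowExp (sumℤ (u ∷ us)) (e ∷ r) ≡ gap e u + rowExp (sumℤ us) r
rowExp-∷-∷ e r u us = begin
  rowExp (u + sumℤ us) (e ∷ r)                                      ≡⟨ rowExp≡ _ (e ∷ r) ⟩
  (proj₁ e + rowSum r) - (u + sumℤ us) + (arrowExp (proj₂ e) + arrowBalance r)
    ≡⟨ regroup (proj₁ e) (rowSum r) u (sumℤ us) (arrowExp (proj₂ e)) (arrowBalance r) ⟩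
  gap e u + (rowSum r - sumℤ us + arrowBalance r)              ≡⟨ cong (λ q → gap e u + q) (sym (rowExp≡ _ r)) ⟩
  gap e u + rowExp (sumℤ us) r                                      ∎
  where
  open ≡-Reasoning
  regroup : ∀ (x S u U a B : ℤ) →
    (x + S) - (u + U) + (a + B) ≡ (x - u + a) + (S - U + B)
  regroup = solve-∀

xExpsA-head : ∀ s (t : ATriangle) → 0 < length t → nth 0ℤ (xExpsA s t) 0 ≡ rowExp s (nth [] t 0)
xExpsA-head s (r ∷ t) _ = refl

xExpsA-suc : ∀ s (t : ATriangle) {r} → suc r < length t →
  nth 0ℤ (xExpsA s t) (suc r) ≡ rowExp (rowSum (nth [] t r)) (nth [] t (suc r))
xExpsA-suc s (r₀ ∷ r₁ ∷ t) {zero}  _         = refl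
xExpsA-suc s (r₀ ∷ t)      {suc r} (s≤s r<n) = xExpsA-suc (rowSum r₀) t r<n

RespectsNW : ℤ × Arrow → ℤ → Set
RespectsNW (x , a) u = u ℤ.≤ x × (x ≡ u → a ≡ ↗)

RespectsNE : ℤ × Arrow → ℤ → Set
RespectsNE (x , a) u = x ℤ.≤ u × (x ≡ u → a ≡ ↖)

gap-natural : ∀ e u → RespectsNW e u → Σ ℕ λ k → gap e u ≡ + k × (k ≡ 0 → proj₁ e ≡ ℤ.suc u)
gap-natural (x , a) u (u≤x , forced) =
  go a ℤ.∣ x - u ∣ (sym (ℤP.0≤i⇒+∣i∣≡i (ℤP.i≤j⇒0≤j-i u≤x))) forced
  where
  x≡u+d : ∀ d → x - u ≡ + d → x ≡ u + + d
  x≡u+d d x-u≡d = trans (split x u) (cong (λ q → u + q) x-u≡d)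
    where
    split : ∀ (x u : ℤ) → x ≡ u + (x - u)
    split = solve-∀
  go : ∀ a d → x - u ≡ + d → (x ≡ u → a ≡ ↗) →
       Σ ℕ λ k → x - u + arrowExp a ≡ + k × (k ≡ 0 → x ≡ ℤ.suc u)
  go ↗  d       x-u≡d _ = suc d , trans (cong (λ q → q + + 1) x-u≡d) (cong +_ (ℕP.+-comm d 1)) , λ ()
  go ↖  zero    x-u≡d f = contradiction (f (trans (x≡u+d 0 x-u≡d) (ℤP.+-identityʳ u))) λ ()
  go ↖  (suc d) x-u≡d _ = d , cong (λ q → q + -1ℤ) x-u≡d ,
                          λ { refl → trans (x≡u+d 1 x-u≡d) (ℤP.+-comm u (+ 1)) }
  go ↖↗ zero    x-u≡d f = contradiction (f (trans (x≡u+d 0 x-u≡d) (ℤP.+-identityʳ u))) λ ()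
  go ↖↗ (suc d) x-u≡d _ = suc d , trans (ℤP.+-identityʳ _) x-u≡d , λ ()

rowExp-natural : ∀ {r us} → Pointwise RespectsNW r us →
  Σ ℕ λ k → rowExp (sumℤ us) r ≡ + k × (k ≡ 0 → map proj₁ r ≡ map ℤ.suc us)
rowExp-natural [] = 0 , refl , λ _ → refl
rowExp-natural {e ∷ r} {u ∷ us} (e∼u ∷ r∼us) with gap-natural e u e∼u | rowExp-natural r∼us
... | k , gap≡k , k≡0⇒ | l , exp≡l , l≡0⇒ =
  k ℕ.+ l ,
  trans (rowExp-∷-∷ e r u us) (cong₂ _+_ gap≡k exp≡l) ,
  λ k+l≡0 → cong₂ _∷_ (k≡0⇒ (ℕP.m+n≡0⇒m≡0 k k+l≡0)) (l≡0⇒ (ℕP.m+n≡0⇒n≡0 k k+l≡0))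

oneToN-above : ∀ {k} (r : List (ℤ × Arrow)) (us : List ℤ) → map proj₁ r ≡ oneToN (suc (suc k)) →
  Pointwise RespectsNW (drop 1 r) us → rowExp (sumℤ us) r ≡ 0ℤ → us ≡ oneToN (suc k)
oneToN-above {k} ((v , a) ∷ r) us vals r∼us exp≡0 with ∷-injective (trans vals (oneToN-suc (suc k)))
... | refl , r-vals with rowExp-natural r∼us
... | l , exp≡l , l≡0⇒ =
  map-injective ℤsuc-injective (trans (sym (l≡0⇒ (head-term a exp≡0′))) r-vals)
  where
  exp≡0′ : (+ 1 + arrowExp a) + + l ≡ 0ℤ
  exp≡0′ = trans (sym (trans (rowExp-∷ (sumℤ us) (+ 1 , a) r) (cong (λ q → + 1 + arrowExp a + q) exp≡l))) exp≡0
  head-term : ∀ a → (+ 1 + arrowExp a) + + l ≡ 0ℤ → l ≡ 0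
  head-term ↗  ()
  head-term ↖  h = ℤP.+-injective h
  head-term ↖↗ ()

apex≡2 : ∀ e → + 1 ℤ.≤ proj₁ e → proj₁ e ℤ.≤ + 3 → isNWNE (proj₂ e) ≡ false →
  rowExp 0ℤ [ e ] ≡ + 1 → proj₁ e ≡ + 2
apex≡2 (+ 2 , _)  _        _ _  _  = refl
apex≡2 (+ 1 , ↗)  _        _ _  ()
apex≡2 (+ 1 , ↖)  _        _ _  ()
apex≡2 (+ 3 , ↗)  _        _ _  ()
apex≡2 (+ 3 , ↖)  _        _ _  ()
apex≡2 (_   , ↖↗) _        _ () _
apex≡2 (+ 0 , _)  (+≤+ ()) _ _  _
apex≡2 (+ suc (suc (suc (suc _))) , _) _ (+≤+ (s≤s (s≤s (s≤s ())))) _ _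

secondRow-forced : ∀ e₁ e₂ → + 1 ℤ.≤ proj₁ e₁ → proj₁ e₁ ℤ.< proj₁ e₂ → proj₁ e₂ ℤ.≤ + 3 →
  RespectsNE e₁ (+ 2) → RespectsNW e₂ (+ 2) → isNWNE (proj₂ e₁) ≡ false → isNWNE (proj₂ e₂) ≡ false →
  rowExp (+ 2) (e₁ ∷ e₂ ∷ []) ≢ + 1 → rowExp (+ 2) (e₁ ∷ e₂ ∷ []) ≢ + 3 →
  proj₁ e₁ ≡ + 1 × proj₁ e₂ ≡ + 3
secondRow-forced (+ 1 , _) (+ 3 , _) _ _ _ _ _ _ _ _ _ = refl , refl
secondRow-forced (+ 1 , ↗) (+ 2 , ↗) _ _ _ _ _ _ _ _ ≢3 = contradiction refl ≢3
secondRow-forced (+ 1 , ↖) (+ 2 , ↗) _ _ _ _ _ _ _ ≢1 _ = contradiction refl ≢1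
secondRow-forced (+ 1 , _) (+ 2 , ↖) _ _ _ _ (_ , forced) _ _ _ _ = contradiction (forced refl) λ ()
secondRow-forced (+ 2 , ↖) (+ 3 , ↗) _ _ _ _ _ _ _ _ ≢3 = contradiction refl ≢3
secondRow-forced (+ 2 , ↖) (+ 3 , ↖) _ _ _ _ _ _ _ ≢1 _ = contradiction refl ≢1
secondRow-forced (+ 2 , ↗) (+ 3 , _) _ _ _ (_ , forced) _ _ _ _ _ = contradiction (forced refl) λ ()
secondRow-forced (+ 2 , _) (+ 2 , _) _ (+<+ (s≤s (s≤s ()))) _ _ _ _ _ _ _
secondRow-forced (_ , ↖↗) _ _ _ _ _ _ () _ _ _
secondRow-forced _ (_ , ↖↗) _ _ _ _ _ _ () _ _
secondRow-forced (+ 0 , _) _ (+≤+ ()) _ _ _ _ _ _ _ _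
secondRow-forced (+ suc (suc (suc _)) , _) _ _ _ _ (+≤+ (s≤s (s≤s ())) , _) _ _ _ _ _
secondRow-forced _ (+ 0 , _) _ _ _ _ (+≤+ () , _) _ _ _ _
secondRow-forced _ (+ 1 , _) _ _ _ _ (+≤+ (s≤s ()) , _) _ _ _ _
secondRow-forced _ (+ suc (suc (suc (suc _))) , _) _ _ (+≤+ (s≤s (s≤s (s≤s ())))) _ _ _ _ _ _

pinnedRow : ℕ → List ℤ
pinnedRow 0             = + 2 ∷ []
pinnedRow 1             = + 1 ∷ + 3 ∷ []
pinnedRow (suc (suc r)) = oneToN (suc (suc (suc r)))

pinned : ℕ → Triangle
pinned n = applyUpTo pinnedRow n

record Pinning (n : ℕ) (M : Monomial) : Set where
  open Monomial M
  field
    no-↖↗ : ew ≡ 0ℤ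
    X₁≡1   : nth 0ℤ eX 0 ≡ + 1
    X₂≢1   : nth 0ℤ eX 1 ≢ + 1
    X₂≢3   : nth 0ℤ eX 1 ≢ + 3
    X≡0    : ∀ j → 3 ≤ j → j < n → nth 0ℤ eX j ≡ 0ℤ

-- Rows and columns are indexed from 0 here, unlike the 1-based ent/arr of the definitions.
module ArrowedTriangle {n : ℕ} {t : ATriangle} (H : IsArrowedMTBottom n t) where

  row : ℕ → List (ℤ × Arrow)
  row r = nth [] t r

  values : ℕ → List ℤ
  values r = map proj₁ (row r)

  cellAt : ℕ → ℕ → ℤ × Arrow
  cellAt r c = nth (0ℤ , ↗) (row r) c

  X : ℕ → ℤ
  X = nth 0ℤ (xExpsA 0ℤ t)

  private
    monotone : IsMonotoneTriangle n (underlying t)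
    monotone = proj₁ (proj₁ H)

    values≡ : ∀ r → nth [] (underlying t) r ≡ values r
    values≡ r = nth-map (map proj₁) [] t r

    entry≡ : ∀ r c → ent (underlying t) (suc r) (suc c) ≡ proj₁ (cellAt r c)
    entry≡ r c = trans (cong (λ vs → nth 0ℤ vs c) (values≡ r)) (nth-map proj₁ (0ℤ , ↗) (row r) c)

  length-t : length t ≡ n
  length-t = trans (sym (length-map (map proj₁) t)) (proj₁ monotone)

  length-row : ∀ {r} → r < n → length (row r) ≡ suc r
  length-row {r} r<n = trans (sym (length-map proj₁ (row r)))
    (trans (cong length (sym (values≡ r))) (proj₁ (proj₂ monotone) (suc r) (s≤s z≤n) r<n))

  row≡cells : ∀ {r} → r < n → row r ≡ applyUpTo (cellAt r) (suc r)
  row≡cells {r} r<n = trans (applyUpTo-nth _ (row r)) (cong (applyUpTo (cellAt r)) (length-row r<n))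

  respectsNW : ∀ {r c} → suc r < n → c ≤ r → RespectsNW (cellAt (suc r) (suc c)) (proj₁ (cellAt r c))
  respectsNW {r} {c} r+1<n c≤r =
    subst₂ ℤ._≤_ (entry≡ r c) (entry≡ (suc r) (suc c))
      (proj₂ (proj₁ (proj₂ (proj₂ monotone)) (suc r) (suc c) (s≤s z≤n) (s≤s c≤r) r+1<n)) ,
    λ e → proj₁ (proj₂ H (suc (suc r)) (suc (suc c)) (s≤s (s≤s z≤n)) r+1<n (s≤s z≤n) (s≤s (s≤s c≤r)))
            (s≤s (s≤s z≤n)) (trans (entry≡ (suc r) (suc c)) (trans e (sym (entry≡ r c))))

  respectsNE : ∀ {r c} → suc r < n → c ≤ r → RespectsNE (cellAt (suc r) c) (proj₁ (cellAt r c))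
  respectsNE {r} {c} r+1<n c≤r =
    subst₂ ℤ._≤_ (entry≡ (suc r) c) (entry≡ r c)
      (proj₁ (proj₁ (proj₂ (proj₂ monotone)) (suc r) (suc c) (s≤s z≤n) (s≤s c≤r) r+1<n)) ,
    λ e → proj₂ (proj₂ H (suc (suc r)) (suc c) (s≤s (s≤s z≤n)) r+1<n (s≤s z≤n) (s≤s (ℕP.m≤n⇒m≤1+n c≤r)))
            (s≤s (s≤s c≤r)) (trans (entry≡ (suc r) c) (trans e (sym (entry≡ r c))))

  increasing : ∀ {r c} → r < n → c < r → proj₁ (cellAt r c) ℤ.< proj₁ (cellAt r (suc c))
  increasing {r} {c} r<n c<r =
    subst₂ ℤ._<_ (entry≡ r c) (entry≡ r (suc c)) (proj₂ (proj₂ (proj₂ monotone)) (suc r) (suc c) (s≤s z≤n) (s≤s c<r) r<n)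

  covers : ∀ {r} → suc r < n → Pointwise RespectsNW (drop 1 (row (suc r))) (values r)
  covers {r} r+1<n = pointwise-nth (0ℤ , ↗) 0ℤ (trans length-tail (sym length-values)) λ c c<len →
    subst₂ RespectsNW (sym (nth-drop1 _ (row (suc r)) c)) (sym (nth-map proj₁ _ (row r) c))
      (respectsNW r+1<n (ℕP.≤-pred (subst (c <_) length-tail c<len)))
    where
    length-tail : length (drop 1 (row (suc r))) ≡ suc r
    length-tail = trans (length-drop 1 (row (suc r))) (cong (ℕ._∸ 1) (length-row r+1<n))
    length-values : length (values r) ≡ suc r
    length-values = trans (length-map proj₁ (row r)) (length-row (ℕP.<⇒≤ r+1<n))

  bottom : ∀ {r} → suc r ≡ n → values r ≡ oneToN (suc r)
  bottom {r} refl = trans (sym (values≡ r)) (proj₂ (proj₁ H))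

  descend : (∀ j → 3 ≤ j → j < n → X j ≡ 0ℤ) → ∀ d {r} → 2 ≤ r → suc (r ℕ.+ d) ≡ n →
    values r ≡ oneToN (suc r)
  descend _ zero {r} _ r+1≡n = bottom (trans (cong suc (sym (ℕP.+-identityʳ r))) r+1≡n)
  descend X≡0 (suc d) {r} 2≤r r+d+2≡n =
    oneToN-above (row (suc r)) (values r)
      (descend X≡0 d (ℕP.≤-trans 2≤r (ℕP.n≤1+n r)) (trans (cong suc (sym (ℕP.+-suc r d))) r+d+2≡n))
      (covers r+1<n)
      (trans (sym (xExpsA-suc 0ℤ t (subst (suc r <_) (sym length-t) r+1<n))) (X≡0 (suc r) (s≤s 2≤r) r+1<n))
    where
    r+1<n : suc r < n
    r+1<n = subst (suc r <_) r+d+2≡n (s≤s (ℕP.m<m+n r (s≤s z≤n)))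

  lowerRows : (∀ j → 3 ≤ j → j < n → X j ≡ 0ℤ) → ∀ {r} → 2 ≤ r → r < n → values r ≡ oneToN (suc r)
  lowerRows X≡0 {r} 2≤r r<n = descend X≡0 (n ℕ.∸ suc r) 2≤r (ℕP.m+[n∸m]≡n r<n)

  noNWNE : All (All (λ e → isNWNE (proj₂ e) ≡ false)) t → ∀ {r c} → r < n → c ≤ r →
    isNWNE (proj₂ (cellAt r c)) ≡ false
  noNWNE no↖↗ r<n c≤r =
    All-nth _ (All-nth [] no↖↗ (subst (_ <_) (sym length-t) r<n)) (subst (_ <_) (sym (length-row r<n)) (s≤s c≤r))

  upperRows : All (All (λ e → isNWNE (proj₂ e) ≡ false)) t → 2 < n →
    X 0 ≡ + 1 → X 1 ≢ + 1 → X 1 ≢ + 3 → values 2 ≡ oneToN 3 →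
    values 0 ≡ + 2 ∷ [] × values 1 ≡ + 1 ∷ + 3 ∷ []
  upperRows no↖↗ 2<n X₁≡1 X₂≢1 X₂≢3 values₂≡ =
    trans (cong (map proj₁) row₀) (cong [_] p≡2) ,
    trans (cong (map proj₁) row₁) (cong₂ (λ a b → a ∷ b ∷ []) (proj₁ q≡1,3) (proj₂ q≡1,3))
    where
    1<n : 1 < n
    1<n = ℕP.<⇒≤ 2<n
    0<n : 0 < n
    0<n = ℕP.<⇒≤ 1<n
    row₀ : row 0 ≡ [ cellAt 0 0 ]
    row₀ = row≡cells 0<n
    row₁ : row 1 ≡ cellAt 1 0 ∷ cellAt 1 1 ∷ []
    row₁ = row≡cells 1<n
    entry₂ : ∀ c → proj₁ (cellAt 2 c) ≡ nth 0ℤ (oneToN 3) c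
    entry₂ c = trans (sym (nth-map proj₁ _ (row 2) c)) (cong (λ vs → nth 0ℤ vs c) values₂≡)
    1≤q₁ : + 1 ℤ.≤ proj₁ (cellAt 1 0)
    1≤q₁ = subst (ℤ._≤ proj₁ (cellAt 1 0)) (entry₂ 0) (proj₁ (respectsNE 2<n z≤n))
    q₂≤3 : proj₁ (cellAt 1 1) ℤ.≤ + 3
    q₂≤3 = subst (proj₁ (cellAt 1 1) ℤ.≤_) (entry₂ 2) (proj₁ (respectsNW 2<n (s≤s z≤n)))
    X₁≡ : X 0 ≡ rowExp 0ℤ [ cellAt 0 0 ]
    X₁≡ = trans (xExpsA-head 0ℤ t (subst (0 <_) (sym length-t) 0<n)) (cong (rowExp 0ℤ) row₀)
    p≡2 : proj₁ (cellAt 0 0) ≡ + 2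
    p≡2 = apex≡2 (cellAt 0 0)
      (ℤP.≤-trans 1≤q₁ (proj₁ (respectsNE 1<n z≤n))) (ℤP.≤-trans (proj₁ (respectsNW 1<n z≤n)) q₂≤3)
      (noNWNE no↖↗ 0<n z≤n) (trans (sym X₁≡) X₁≡1)
    X₂≡ : X 1 ≡ rowExp (+ 2) (cellAt 1 0 ∷ cellAt 1 1 ∷ [])
    X₂≡ = trans (xExpsA-suc 0ℤ t (subst (1 <_) (sym length-t) 1<n))
                (cong₂ rowExp (trans (cong rowSum row₀) (cong (_+ 0ℤ) p≡2)) row₁)
    q≡1,3 : proj₁ (cellAt 1 0) ≡ + 1 × proj₁ (cellAt 1 1) ≡ + 3
    q≡1,3 = secondRow-forced (cellAt 1 0) (cellAt 1 1) 1≤q₁ (increasing 1<n (s≤s z≤n)) q₂≤3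
      (subst (RespectsNE _) p≡2 (respectsNE 1<n z≤n)) (subst (RespectsNW _) p≡2 (respectsNW 1<n z≤n))
      (noNWNE no↖↗ 1<n z≤n) (noNWNE no↖↗ 1<n (s≤s z≤n))
      (λ e → X₂≢1 (trans X₂≡ e)) (λ e → X₂≢3 (trans X₂≡ e))

  underlying≡pinned : 2 < n → Pinning n (weightA t) → underlying t ≡ pinned n
  underlying≡pinned 2<n P = Pointwise-≡⇒≡ (pointwise-nth [] [] lengths λ r r<len →
      let r<n = subst (r <_) (proj₁ monotone) r<len in
      trans (values≡ r) (trans (rowValues r<n) (sym (nth-applyUpTo [] pinnedRow r<n))))
    where
    open Pinning P
    lengths : length (underlying t) ≡ length (pinned n)
    lengths = trans (proj₁ monotone) (sym (length-applyUpTo pinnedRow n))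
    no↖↗ : All (All (λ e → isNWNE (proj₂ e) ≡ false)) t
    no↖↗ = All.concat⁻ (countB≡0⇒All _ (concat t) (ℤP.+-injective no-↖↗))
    upper : values 0 ≡ + 2 ∷ [] × values 1 ≡ + 1 ∷ + 3 ∷ []
    upper = upperRows no↖↗ 2<n X₁≡1 X₂≢1 X₂≢3 (lowerRows X≡0 ℕP.≤-refl 2<n)
    rowValues : ∀ {r} → r < n → values r ≡ pinnedRow r
    rowValues {0}           _   = proj₁ upper
    rowValues {1}           _   = proj₂ upper
    rowValues {suc (suc r)} r<n = lowerRows X≡0 (s≤s (s≤s z≤n)) r<n

hookDPP : ℕ → Filling
hookDPP x = ((3 ∷ []) ∷ (x ∷ []) ∷ (x ∷ []) ∷ (2 ∷ []) ∷ []) ∷ ((2 ∷ []) ∷ []) ∷ ((1 ∷ []) ∷ []) ∷ []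

data HookCell : ℕ → ℕ → Set where
  c₁₁ : HookCell 1 1
  c₁₂ : HookCell 1 2
  c₁₃ : HookCell 1 3
  c₁₄ : HookCell 1 4
  c₂₁ : HookCell 2 1
  c₃₁ : HookCell 3 1

hookCell : ∀ {x} i j → InShape (hookDPP x) i j → HookCell i j
hookCell 1 1 _ = c₁₁
hookCell 1 2 _ = c₁₂
hookCell 1 3 _ = c₁₃
hookCell 1 4 _ = c₁₄
hookCell 2 1 _ = c₂₁
hookCell 3 1 _ = c₃₁
hookCell 0                         _                   (() , _)
hookCell (suc _)                   0                   (_ , _ , () , _)
hookCell 1 (suc (suc (suc (suc (suc _))))) (_ , _ , _ , s≤s (s≤s (s≤s (s≤s ()))))
hookCell 2 (suc (suc _))           (_ , _ , _ , s≤s ())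
hookCell 3 (suc (suc _))           (_ , _ , _ , s≤s ())
hookCell (suc (suc (suc (suc _)))) _                   (_ , s≤s (s≤s (s≤s ())) , _)

module HookDPP (m x : ℕ) (2≤x : 2 ≤ x) (x≤3 : x ≤ 3) where

  t : Filling
  t = hookDPP x

  n : ℕ
  n = 3 ℕ.+ m

  singleton : ∀ {i j} → HookCell i j → Σ ℕ λ v → cell t i j ≡ [ v ] × 1 ≤ v × v ≤ 3
  singleton c₁₁ = 3 , refl , s≤s z≤n , ℕP.≤-refl
  singleton c₁₂ = x , refl , ℕP.≤-trans (s≤s z≤n) 2≤x , x≤3
  singleton c₁₃ = x , refl , ℕP.≤-trans (s≤s z≤n) 2≤x , x≤3
  singleton c₁₄ = 2 , refl , s≤s z≤n , s≤s (s≤s z≤n)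
  singleton c₂₁ = 2 , refl , s≤s z≤n , s≤s (s≤s z≤n)
  singleton c₃₁ = 1 , refl , s≤s z≤n , s≤s z≤n

  partitionShape : IsPartitionShape t
  partitionShape = nonempty , decreasing
    where
    nonempty : ∀ i → 1 ≤ i → i ≤ 3 → 1 ≤ rowLen t i
    nonempty 1 _ _ = s≤s z≤n
    nonempty 2 _ _ = s≤s z≤n
    nonempty 3 _ _ = s≤s z≤n
    nonempty (suc (suc (suc (suc _)))) _ (s≤s (s≤s (s≤s ())))
    decreasing : ∀ i → 1 ≤ i → i < 3 → rowLen t (suc i) ≤ rowLen t i
    decreasing 1 _ _ = s≤s z≤n
    decreasing 2 _ _ = s≤s z≤n
    decreasing (suc (suc (suc _))) _ (s≤s (s≤s (s≤s ())))

  durfee≡1 : ∀ i → 1 ≤ i → i ≤ frobL t → i ≡ 1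
  durfee≡1 1 _ _ = refl
  durfee≡1 (suc (suc _)) _ (s≤s ())

  cells : ∀ i j → InShape t i j →
    (cell t i j ≢ []) × AllPairs _<_ (cell t i j) × All (λ v → 1 ≤ v × v ≤ n) (cell t i j)
  cells i j s with singleton (hookCell i j s)
  ... | v , e , 1≤v , v≤3 rewrite e = (λ ()) , [] ∷ [] , (1≤v , ℕP.≤-trans v≤3 (ℕP.m≤m+n 3 m)) ∷ []

  singletons : ∀ i j → InShape t i j → length (cell t i j) ≡ 1
  singletons i j s rewrite proj₁ (proj₂ (singleton (hookCell i j s))) = refl

  rowMaxima : ∀ i j → 1 ≤ j → InShape t i (suc j) → maxL (cell t i (suc j)) ≤ maxL (cell t i j)
  rowMaxima i j 1≤j s = go (hookCell i (suc j) s) 1≤j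
    where
    go : ∀ {i j} → HookCell i (suc j) → 1 ≤ j → maxL (cell t i (suc j)) ≤ maxL (cell t i j)
    go c₁₂ _ = subst (_≤ 3) (sym (ℕP.⊔-identityʳ x)) x≤3
    go c₁₃ _ = ℕP.≤-refl
    go c₁₄ _ = subst (2 ≤_) (sym (ℕP.⊔-identityʳ x)) 2≤x

  columns : ∀ i j → 1 ≤ i → InShape t (suc i) j →
    ∀ a → a ∈ cell t i j → ∀ b → b ∈ cell t (suc i) j → b < a
  columns i j 1≤i s = go (hookCell (suc i) j s) 1≤i
    where
    go : ∀ {i j} → HookCell (suc i) j → 1 ≤ i → ∀ a → a ∈ cell t i j → ∀ b → b ∈ cell t (suc i) j → b < a
    go c₂₁ _ _ (here refl) _ (here refl) = s≤s (s≤s (s≤s z≤n))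
    go c₃₁ _ _ (here refl) _ (here refl) = s≤s (s≤s z≤n)

  diagonal : ∀ i d → InShape t i i → cell t i i ≡ [ d ] →
    (colLen t i ≡ i ℕ.+ d ℕ.∸ 1) × (∀ k → i < k → k ≤ colLen t i → cell t k i ≡ [ d ℕ.∸ (k ℕ.∸ i) ])
  diagonal i d s = go (hookCell i i s)
    where
    go : ∀ {i} → HookCell i i → cell t i i ≡ [ d ] →
      (colLen t i ≡ i ℕ.+ d ℕ.∸ 1) × (∀ k → i < k → k ≤ colLen t i → cell t k i ≡ [ d ℕ.∸ (k ℕ.∸ i) ])
    go c₁₁ refl = refl , below
      where
      below : ∀ k → 1 < k → k ≤ 3 → cell t k 1 ≡ [ 3 ℕ.∸ (k ℕ.∸ 1) ]
      below 2 _ _ = refl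
      below 3 _ _ = refl
      below 1 (s≤s ()) _
      below (suc (suc (suc (suc _)))) _ (s≤s (s≤s (s≤s ())))

  frobenius : ∀ i → 1 ≤ i → i ≤ frobL t → frobA t i ≡ suc (frobB t i)
  frobenius i 1≤i i≤l with durfee≡1 i 1≤i i≤l
  ... | refl = refl

  noOneAboveDiagonal : ∀ i j → InShape t i j → i < j → ¬ (1 ∈ cell t i j)
  noOneAboveDiagonal i j s = go (hookCell i j s)
    where
    go : ∀ {i j} → HookCell i j → i < j → ¬ (1 ∈ cell t i j)
    go c₁₂ _ (here 1≡x) = ℕP.<-irrefl 1≡x 2≤x
    go c₁₃ _ (here 1≡x) = ℕP.<-irrefl 1≡x 2≤x
    go c₁₄ _ (here ())
    go c₁₁ (s≤s ())
    go c₂₁ (s≤s ())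
    go c₃₁ (s≤s ())

  isDPP : IsDPPSBCSPP n t
  isDPP = (partitionShape , (λ i 1≤i i≤l → inj₂ (frobenius i 1≤i i≤l)) , cells ,
           (λ i j s _ → singletons i j s) , rowMaxima , columns) ,
          singletons , frobenius , diagonal , noOneAboveDiagonal

nth-weightS-X : ∀ {n j} t → j < n →
  nth 0ℤ (Monomial.eX (weightS n t)) j ≡ + countB (λ x → x ℕ.≡ᵇ suc j) (allEntries t)
nth-weightS-X {n} t j<n = trans (cong (λ xs → nth 0ℤ xs _) (map-applyUpTo (λ k → k) _ n)) (nth-applyUpTo 0ℤ _ j<n)

entriesBelow4⇒X≡0 : ∀ {n} t → (∀ j → countB (λ x → x ℕ.≡ᵇ 4 ℕ.+ j) (allEntries t) ≡ 0) →
  ∀ j → 3 ≤ j → j < n → nth 0ℤ (Monomial.eX (weightS n t)) j ≡ 0ℤ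
entriesBelow4⇒X≡0 t none (suc (suc (suc j))) _ j<n = trans (nth-weightS-X t j<n) (cong +_ (none j))
entriesBelow4⇒X≡0 t none (suc zero)       (s≤s ())       _
entriesBelow4⇒X≡0 t none (suc (suc zero)) (s≤s (s≤s ())) _

hookDPP-pinning : ∀ m {x} → 2 ≤ x → x ≤ 3 → Pinning (3 ℕ.+ m) (weightS (3 ℕ.+ m) (hookDPP x))
hookDPP-pinning m {2} _ _ = record
  { no-↖↗ = refl ; X₁≡1 = refl ; X₂≢1 = λ () ; X₂≢3 = λ () ; X≡0 = entriesBelow4⇒X≡0 (hookDPP 2) λ _ → refl }
hookDPP-pinning m {3} _ _ = record
  { no-↖↗ = refl ; X₁≡1 = refl ; X₂≢1 = λ () ; X₂≢3 = λ () ; X≡0 = entriesBelow4⇒X≡0 (hookDPP 3) λ _ → refl }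
hookDPP-pinning m {1} (s≤s ()) _
hookDPP-pinning m {suc (suc (suc (suc _)))} _ (s≤s (s≤s (s≤s ())))

proposition2p7 : (n : ℕ) → 3 ≤ n →
    ¬ (Σ (ATriangle → Filling) λ φ → Σ (Filling → ATriangle) λ φ⁻¹ →
         IsBijectionBetween (IsArrowedMTBottom n) (IsSBCSPP n) φ φ⁻¹
       × (∀ A → IsArrowedMTBottom n A → weightS n (φ A) ≡ weightA A)
       × IsBijectiveOnto (IsDPPSBCSPP n) (IsMTBottom n) (λ D → underlying (φ⁻¹ D)))
proposition2p7 (suc (suc (suc m))) (s≤s (s≤s (s≤s z≤n)))
  (_ , φ⁻¹ , (_ , φ⁻¹-arrowed , _ , φφ⁻¹≡id) , φ-weight , (_ , underlying-injective , _)) =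
  hookDPP2≢hookDPP3 (underlying-injective (hookDPP 2) (hookDPP 3) (isDPP 2≤2 2≤3) (isDPP 2≤3 3≤3)
    (trans (pinnedPreimage 2≤2 2≤3) (sym (pinnedPreimage 2≤3 3≤3))))
  where
  n : ℕ
  n = 3 ℕ.+ m
  2≤2 : 2 ≤ 2
  2≤2 = ℕP.≤-refl
  2≤3 : 2 ≤ 3
  2≤3 = ℕP.n≤1+n 2
  3≤3 : 3 ≤ 3
  3≤3 = ℕP.≤-refl
  hookDPP2≢hookDPP3 : hookDPP 2 ≢ hookDPP 3
  hookDPP2≢hookDPP3 ()
  isDPP : ∀ {x} → 2 ≤ x → x ≤ 3 → IsDPPSBCSPP n (hookDPP x)
  isDPP 2≤x x≤3 = HookDPP.isDPP m _ 2≤x x≤3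
  pinnedPreimage : ∀ {x} → 2 ≤ x → x ≤ 3 → underlying (φ⁻¹ (hookDPP x)) ≡ pinned n
  pinnedPreimage {x} 2≤x x≤3 = ArrowedTriangle.underlying≡pinned arrowed (s≤s (s≤s (s≤s z≤n)))
      (subst (Pinning n) weight≡ (hookDPP-pinning m 2≤x x≤3))
    where
    sbcspp : IsSBCSPP n (hookDPP x)
    sbcspp = proj₁ (isDPP 2≤x x≤3)
    arrowed : IsArrowedMTBottom n (φ⁻¹ (hookDPP x))
    arrowed = φ⁻¹-arrowed (hookDPP x) sbcspp
    weight≡ : weightS n (hookDPP x) ≡ weightA (φ⁻¹ (hookDPP x))
    weight≡ = trans (cong (weightS n) (sym (φφ⁻¹≡id _ sbcspp))) (φ-weight _ arrowed)
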